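{- Let $G=(V,E)$ be a multigraph, $e\in E$, $k\ge\Delta(G)+1$, $T$ a tree sequence with respect to $G$ and $e$, $C\subseteq[k]$, and $\varphi$ a $k$-edge-coloring of $G-e$. Suppose $V(T)$ is closed with respect to $\varphi$, and let $f$ be an edge with ends $u\notin V(T)$ and $v\in V(T)$. If there exists a $(T,C\cup\{\varphi(f)\},\varphi)$-stable coloring $\pi$ such that $\overline{\pi}(u)\cap\overline{\pi}(V(T))\ne\emptyset$, then $f$ is $T\vee C$-nonextendable with respect to $\varphi$.
   Context: Multigraphs are finite, loopless, parallel edges allowed; $\Delta(G)$ is the maximum degree; $[k]=\{1,\dots,k\}$. A $k$-edge-coloring of $G-e$ is a map from $E-\{e\}$ to $[k]$ giving adjacent edges distinct colors; for such $\pi$, $\overline{\pi}(v)$ is the set of colors of $[k]$ missing at $v$ (not on any edge of $G-e$ at $v$) and $\overline{\pi}(X)=\bigcup_{v\in X}\overline{\pi}(v)$. $\partial(X)$ denotes the set of edges with exactly one end in $X$. A set $X$ is closed with respect to $\pi$ if no edge of $\partial(X)-\{e\}$ has a color in $\overline{\pi}(X)$. A tree sequence with respect to $G$ and $e$ is a sequence $T=(y_0,e_1,y_1,\dots,e_p,y_p)$, $p\ge1$, of distinct vertices and distinct edges with $e_1=e$ and each $e_j$ joining $y_j$ to some $y_i$, $i<j$; $V(T)=\{y_0,\dots,y_p\}$. A $k$-edge-coloring $\pi$ of $G-e$ is $(T,C,\varphi)$-stable if (i) $\pi(f)=\varphi(f)$ for every edge $f\ne e$ incident to $V(T)$ with $\varphi(f)\in\overline{\varphi}(V(T))\cup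 C$, and (ii) $\overline{\pi}(v)=\overline{\varphi}(v)$ for all $v\in V(T)$. For colors $\alpha,\beta$, a path $P$ with at least two vertices whose edges are colored alternately $\alpha$ and $\beta$ by $\pi$, with ends $w$ and $v\in V(T)$, is a $(T,\pi,\{\alpha,\beta\})$-exit path if $V(T)\cap V(P)=\{v\}$ and $\overline{\pi}(w)\cap\{\alpha,\beta\}\ne\emptyset$; then $v$ is called a $(T,\pi,\{\alpha,\beta\})$-exit. An edge $f\in\partial(V(T))$ with end $v\in V(T)$ is $T\vee C$-nonextendable with respect to $\varphi$ if there exist a $(T,C\cup\{\varphi(f)\},\varphi)$-stable coloring $\pi$ and a color $\alpha\in\overline{\pi}(v)$ such that $v$ is a $(T,\pi,\{\alpha,\varphi(f)\})$-exit. -}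

module Defs where

open import Data.Nat using (ℕ; zero; suc; _≤_; _⊔_)
open import Data.Fin using (Fin; zero; suc; toℕ; inject₁; fromℕ; _≟_)
open import Data.List using (List; map; allFin; foldr)
open import Data.Nat.ListAction using (sum)
open import Data.Product using (Σ; ∃; ∃-syntax; _×_; _,_)
open import Data.Sum using (_⊎_)
open import Data.Bool using (if_then_else_; _∨_)
open import Relation.Nullary using (¬_; does)
open import Relation.Binary.PropositionalEquality using (_≡_; _≢_)
open import Function.Definitions using (Injective)

record Multigraph : Set where
  field
    n m      : ℕ
    src tgt  : Fin m → Fin n
    loopless : ∀ f → src f ≢ tgt f

module _ (G : Multigraph) where
  open Multigraph G

  Vtx : Set
  Vtx = Fin n

  Edge : Set
  Edge = Fin m

  Incident : Vtx → Edge → Set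
  Incident v f = src f ≡ v ⊎ tgt f ≡ v

  Joins : Vtx → Vtx → Edge → Set
  Joins a b f = (src f ≡ a × tgt f ≡ b) ⊎ (src f ≡ b × tgt f ≡ a)

  degree : Vtx → ℕ
  degree v = sum (map (λ f → if does (src f ≟ v) ∨ does (tgt f ≟ v) then 1 else 0) (allFin m))

  maxDegree : ℕ
  maxDegree = foldr _⊔_ 0 (map degree (allFin n))

  InBoundary : (Vtx → Set) → Edge → Set
  InBoundary X f = (X (src f) × ¬ X (tgt f)) ⊎ (¬ X (src f) × X (tgt f))

  module _ (e : Edge) (k : ℕ) where

    -- A k-edge-coloring of G - e: a map to [k] = Fin k whose value at e is
    -- irrelevant (never used); adjacent distinct edges of G - e get distinct colors.
    IsColoring : (Edge → Fin k) → Set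
    IsColoring π = ∀ f g → f ≢ e → g ≢ e → f ≢ g →
                   (∃[ v ] (Incident v f × Incident v g)) → π f ≢ π g

    Missing : (Edge → Fin k) → Vtx → Fin k → Set
    Missing π v c = ∀ f → f ≢ e → Incident v f → π f ≢ c

    MissingSet : (Edge → Fin k) → (Vtx → Set) → Fin k → Set
    MissingSet π X c = ∃[ v ] (X v × Missing π v c)

    Closed : (Vtx → Set) → (Edge → Fin k) → Set
    Closed X π = ∀ f → f ≢ e → InBoundary X f → ¬ MissingSet π X (π f)

  -- Tree sequence (y₀, e₁, y₁, …, e_p, y_p), p = suc p' ≥ 1.
  -- y i is y_i; ed j is e_{j+1}.
  record TreeSeq (e : Edge) : Set where
    field
      p'    : ℕ
      y     : Fin (suc (suc p')) → Vtx
      ed    : Fin (suc p') → Edge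
      y-inj : Injective _≡_ _≡_ y
      ed-inj : Injective _≡_ _≡_ ed
      first : ed zero ≡ e
      joins : ∀ (j : Fin (suc p')) →
              ∃[ i ] (toℕ i ≤ toℕ j × Joins (y (suc j)) (y i) (ed j))

  InT : ∀ {e} → TreeSeq e → Vtx → Set
  InT T v = ∃[ i ] (TreeSeq.y T i ≡ v)

  module _ {e : Edge} {k : ℕ} (T : TreeSeq e) where

    Stable : (Fin k → Set) → (Edge → Fin k) → (Edge → Fin k) → Set
    Stable C φ π =
      IsColoring e k π ×
      (∀ f → f ≢ e → (∃[ v ] (InT T v × Incident v f)) →
         (MissingSet e k φ (InT T) (φ f) ⊎ C (φ f)) → π f ≡ φ f) ×
      (∀ v → InT T v → ∀ c → (Missing e k π v c → Missing e k φ v c)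
                            × (Missing e k φ v c → Missing e k π v c))

    -- (T, π, {α, β})-exit path from v ∈ V(T) to w: vertices vs 0 = v, …,
    -- vs (q+1) = w (distinct, at least two), edges gs j joining vs j and vs (j+1),
    -- all edges of G - e, colored alternately α and β.
    record ExitPath (π : Edge → Fin k) (α β : Fin k) (v : Vtx) : Set where
      field
        q      : ℕ
        vs     : Fin (suc (suc q)) → Vtx
        gs     : Fin (suc q) → Edge
        vs-inj : Injective _≡_ _≡_ vs
        start  : vs zero ≡ v
        gs-join : ∀ j → Joins (vs (inject₁ j)) (vs (suc j)) (gs j)
        gs-ne  : ∀ j → gs j ≢ e
        gs-col : ∀ j → π (gs j) ≡ α ⊎ π (gs j) ≡ β
        alt    : ∀ (j : Fin q) → π (gs (inject₁ j)) ≢ π (gs (suc j))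
        meetT  : ∀ i → InT T (vs i) → vs i ≡ v
        endMissing : Missing e k π (vs (fromℕ (suc q))) α
                   ⊎ Missing e k π (vs (fromℕ (suc q))) β

    IsExit : (Edge → Fin k) → Fin k → Fin k → Vtx → Set
    IsExit π α β v = ExitPath π α β v

    NonExtendable : (Fin k → Set) → (Edge → Fin k) → Edge → Vtx → Set
    NonExtendable C φ f v =
      ∃[ π ] (Stable (λ c → C c ⊎ c ≡ φ f) φ π ×
              ∃[ α ] (Missing e k π v α × IsExit π α (φ f) v))

-- Pick a colour α missing at v, which exists because k > Δ(G). The colour c missing
-- at u and α both lie in π̄(V(T)), and a stable colouring keeps V(T) closed, so no edge
-- coloured α or c leaves V(T). The region reached from u along such edges therefore
-- avoids V(T), and interchanging α and c on it yields a stable colouring in which u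
-- misses α while f keeps its colour φ(f); the single edge f is then an exit path from v.
module Submission where

open import Defs
open import Data.Nat using (ℕ; zero; suc; _≤_; _<_; _⊔_; z≤n)
open import Data.Nat.Properties
  using (≤-trans; ≤-<-trans; <-≤-trans; ≤-pred; n≮0; <-irrefl; m≤m⊔n; m≤n⊔m; module ≤-Reasoning)
open import Data.Fin using (Fin; zero; suc; _≟_)
open import Data.Fin.Properties using (suc-injective; 0≢1+n; any?)
open import Data.Fin.Subset using (Subset; _∈_; _∉_; _-_; ∣_∣; ∁; ⁅_⁆)
open import Data.Fin.Subset.Properties
  using (_∈?_; ∣p∣≤n; x∈p∧x≢y⇒x∈p-y; x∈p⇒∣p-x∣<∣p∣; p─q⊆p; x∈⁅x⁆; x∈⁅y⁆⇒x≡y;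
         x∈p⇒x∉∁p; x∈∁p⇒x∉p; x∉p⇒x∈∁p; x∉∁p⇒x∈p)
open import Data.Fin.Permutation.Components using (transpose; transpose-inverse)
open import Data.Bool using (Bool; true; false; if_then_else_)
open import Data.List using (foldr)
import Data.List as List
open import Data.List.Properties using (map-tabulate)
open import Data.Nat.ListAction using (sum)
import Data.Vec as Vec
open import Data.Vec.Properties using (lookup⇒[]=; lookup∘tabulate)
open import Data.Product using (∃-syntax; _×_; _,_; proj₁; proj₂)
open import Data.Sum using (_⊎_; inj₁; inj₂; swap)
open import Function using (_∘_; id)
open import Function.Definitions using (Injective)
open import Relation.Nullary using (Dec; yes; no; does; ¬_; contradiction)
open import Relation.Nullary.Decidable using (dec-true; _⊎-dec_; _×-dec_; ¬?)
open import Relation.Unary using (Decidable)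
open import Relation.Binary.PropositionalEquality using (_≡_; _≢_; refl; sym; trans; cong; subst)

injective⇒≤∣p∣ : ∀ {k n} (p : Subset n) {h : Fin k → Fin n} → Injective _≡_ _≡_ h →
                 (∀ i → h i ∈ p) → k ≤ ∣ p ∣
injective⇒≤∣p∣ {zero}  p h-inj h∈p = z≤n
injective⇒≤∣p∣ {suc k} p {h} h-inj h∈p =
  ≤-<-trans (injective⇒≤∣p∣ (p - h zero) (suc-injective ∘ h-inj) h∘suc∈p-h₀)
            (x∈p⇒∣p-x∣<∣p∣ (h∈p zero))
  where
  h∘suc∈p-h₀ : ∀ i → h (suc i) ∈ p - h zero
  h∘suc∈p-h₀ i = x∈p∧x≢y⇒x∈p-y (h∈p (suc i)) (0≢1+n ∘ sym ∘ h-inj)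

sum-indicator≡∣tabulate∣ : ∀ {n} (b : Fin n → Bool) →
                          sum (List.tabulate (λ i → if b i then 1 else 0)) ≡ ∣ Vec.tabulate b ∣
sum-indicator≡∣tabulate∣ {zero}  b = refl
sum-indicator≡∣tabulate∣ {suc n} b with b zero
... | true  = cong suc (sum-indicator≡∣tabulate∣ (b ∘ suc))
... | false = sum-indicator≡∣tabulate∣ (b ∘ suc)

entry≤foldr-⊔ : ∀ {n} (g : Fin n → ℕ) i → g i ≤ foldr _⊔_ 0 (List.tabulate g)
entry≤foldr-⊔ g zero    = m≤m⊔n _ _
entry≤foldr-⊔ g (suc i) = ≤-trans (entry≤foldr-⊔ (g ∘ suc) i) (m≤n⊔m (g zero) _)

transpose-matchˡ : ∀ {n} (i j : Fin n) → transpose i j i ≡ j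
transpose-matchˡ i j rewrite dec-true (i ≟ i) refl = refl

transpose-matchʳ : ∀ {n} (i j : Fin n) → transpose i j j ≡ i
transpose-matchʳ i j with j ≟ i
... | yes j≡i = j≡i
... | no _ rewrite dec-true (j ≟ j) refl = refl

transpose-injective : ∀ {n} (i j : Fin n) → Injective _≡_ _≡_ (transpose i j)
transpose-injective i j eq =
  trans (sym (transpose-inverse j i)) (trans (cong (transpose j i) eq) (transpose-inverse j i))

transpose-preserves-pair : ∀ {n} {i j γ : Fin n} → γ ≡ i ⊎ γ ≡ j →
                           transpose i j γ ≡ i ⊎ transpose i j γ ≡ j
transpose-preserves-pair {i = i} {j} (inj₁ refl) = inj₂ (transpose-matchˡ i j)
transpose-preserves-pair {i = i} {j} (inj₂ refl) = inj₁ (transpose-matchʳ i j)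

module Incidence (G : Multigraph) where
  open Multigraph G

  incident? : ∀ v f → Dec (Incident G v f)
  incident? v f = (src f ≟ v) ⊎-dec (tgt f ≟ v)

  joins-incidentˡ : ∀ {a b g} → Joins G a b g → Incident G a g
  joins-incidentˡ (inj₁ (s , _)) = inj₁ s
  joins-incidentˡ (inj₂ (_ , t)) = inj₂ t

  joins-incidentʳ : ∀ {a b g} → Joins G a b g → Incident G b g
  joins-incidentʳ (inj₁ (_ , t)) = inj₂ t
  joins-incidentʳ (inj₂ (s , _)) = inj₁ s

  joins-ends : ∀ {a b x g} → Joins G a b g → Incident G x g → x ≡ a ⊎ x ≡ b
  joins-ends (inj₁ (s , _)) (inj₁ refl) = inj₁ s
  joins-ends (inj₁ (_ , t)) (inj₂ refl) = inj₂ t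
  joins-ends (inj₂ (s , _)) (inj₁ refl) = inj₂ s
  joins-ends (inj₂ (_ , t)) (inj₂ refl) = inj₁ t

  boundary-inner-end : ∀ {X : Vtx G → Set} {g} → InBoundary G X g → ∃[ x ] (X x × Incident G x g)
  boundary-inner-end (inj₁ (s , _)) = _ , s , inj₁ refl
  boundary-inner-end (inj₂ (_ , t)) = _ , t , inj₂ refl

  incidentEdges : Vtx G → Subset m
  incidentEdges v = Vec.tabulate (does ∘ incident? v)

  incident⇒∈incidentEdges : ∀ {v f} → Incident G v f → f ∈ incidentEdges v
  incident⇒∈incidentEdges {v} {f} inc =
    lookup⇒[]= f _ (trans (lookup∘tabulate _ f) (dec-true (incident? v f) inc))

  degree≡∣incidentEdges∣ : ∀ v → degree G v ≡ ∣ incidentEdges v ∣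
  degree≡∣incidentEdges∣ v =
    trans (cong sum (map-tabulate id (λ f → if does (incident? v f) then 1 else 0)))
          (sum-indicator≡∣tabulate∣ (does ∘ incident? v))

  degree≤maxDegree : ∀ v → degree G v ≤ maxDegree G
  degree≤maxDegree v =
    subst (degree G v ≤_) (cong (foldr _⊔_ 0) (sym (map-tabulate id (degree G))))
          (entry≤foldr-⊔ (degree G) v)

module Regions (G : Multigraph) where
  open Multigraph G

  boundary? : (S : Subset n) → ∀ g → Dec (InBoundary G (_∈ S) g)
  boundary? S g = ((src g ∈? S) ×-dec ¬? (tgt g ∈? S)) ⊎-dec (¬? (src g ∈? S) ×-dec (tgt g ∈? S))

  module _ {Sel : Edge G → Set} (Sel? : Decidable Sel) {A : Vtx G → Set}
           (A-closed : ∀ g → Sel g → ¬ InBoundary G A g) where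

    -- The region grown from u is the complement of U; shrinking U lets ∣ U ∣ bound the recursion.
    private
      Avoids : Subset n → Set
      Avoids U = ∀ x → x ∉ U → ¬ A x

      Shrinking : Subset n → Set
      Shrinking U = ∃[ U′ ] (Avoids U′ × (∀ x → x ∉ U → x ∉ U′) ×
                             (∀ g → Sel g → ¬ InBoundary G (_∈ U′) g))

      avoids-remove : ∀ {U y} → Avoids U → ¬ A y → Avoids (U - y)
      avoids-remove {U} {y} avoid ¬Ay x x∉U-y with x ≟ y
      ... | yes refl = ¬Ay
      ... | no x≢y   = avoid x (x∉U-y ∘ λ x∈U → x∈p∧x≢y⇒x∈p-y x∈U x≢y)

      avoids-all-but : ∀ {u} → ¬ A u → Avoids (∁ ⁅ u ⁆)
      avoids-all-but {u} ¬Au x x∉∁u rewrite x∈⁅y⁆⇒x≡y u (x∉∁p⇒x∈p x∉∁u) = ¬Au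

      complement-boundary : ∀ {U g} → InBoundary G (_∈ ∁ U) g → InBoundary G (_∈ U) g
      complement-boundary (inj₁ (s , t)) = inj₂ (x∈∁p⇒x∉p s , x∉∁p⇒x∈p t)
      complement-boundary (inj₂ (s , t)) = inj₁ (x∉∁p⇒x∈p s , x∈∁p⇒x∉p t)

      shrink : ∀ fuel U → ∣ U ∣ ≤ fuel → Avoids U → Shrinking U
      remove : ∀ fuel U y → ∣ U ∣ ≤ fuel → Avoids U → y ∈ U → ¬ A y → Shrinking U

      shrink fuel U bound avoid with any? (λ g → Sel? g ×-dec boundary? U g)
      ... | no none = U , avoid , (λ _ x∉U → x∉U) , (λ g sel cross → none (g , sel , cross))
      ... | yes (g , sel , inj₁ (s∈U , t∉U)) =
        remove fuel U (src g) bound avoid s∈U (λ As → A-closed g sel (inj₁ (As , avoid _ t∉U)))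
      ... | yes (g , sel , inj₂ (s∉U , t∈U)) =
        remove fuel U (tgt g) bound avoid t∈U (λ At → A-closed g sel (inj₂ (avoid _ s∉U , At)))

      remove zero U y bound avoid y∈U ¬Ay = contradiction (<-≤-trans (x∈p⇒∣p-x∣<∣p∣ y∈U) bound) n≮0
      remove (suc fuel) U y bound avoid y∈U ¬Ay
        with U′ , avoid′ , U-y⊇U′ , closed′ ←
             shrink fuel (U - y) (≤-pred (<-≤-trans (x∈p⇒∣p-x∣<∣p∣ y∈U) bound))
                    (avoids-remove avoid ¬Ay)
        = U′ , avoid′ , (λ x x∉U → U-y⊇U′ x (x∉U ∘ p─q⊆p U ⁅ y ⁆)) , closed′

    closedRegionAvoiding : ∀ u → ¬ A u →
      ∃[ S ] (u ∈ S × (∀ x → x ∈ S → ¬ A x) × (∀ g → Sel g → ¬ InBoundary G (_∈ S) g))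
    closedRegionAvoiding u ¬Au
      with U , avoid , mono , closed ← shrink n (∁ ⁅ u ⁆) (∣p∣≤n (∁ ⁅ u ⁆)) (avoids-all-but ¬Au)
      = ∁ U , x∉p⇒x∈∁p (mono u (x∈p⇒x∉∁p (x∈⁅x⁆ u))) , (λ x → avoid x ∘ x∈∁p⇒x∉p) ,
        (λ g sel → closed g sel ∘ complement-boundary)

module Colourings (G : Multigraph) (e : Edge G) (k : ℕ) where
  open Multigraph G
  open Incidence G
  open Regions G

  colourAt? : (π : Edge G → Fin k) → ∀ v γ → Dec (∃[ g ] (g ≢ e × Incident G v g × π g ≡ γ))
  colourAt? π v γ = any? (λ g → ¬? (g ≟ e) ×-dec incident? v g ×-dec (π g ≟ γ))

  ¬missing⇒present : ∀ {π v γ} → ¬ Missing G e k π v γ → ∃[ g ] (g ≢ e × Incident G v g × π g ≡ γ)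
  ¬missing⇒present {π} {v} {γ} ¬missing with colourAt? π v γ
  ... | yes present = present
  ... | no absent   = contradiction (λ g g≢e inc πg≡γ → absent (g , g≢e , inc , πg≡γ)) ¬missing

  missing-colour : ∀ {π} → IsColoring G e k π → maxDegree G < k → ∀ v → ∃[ α ] Missing G e k π v α
  missing-colour {π} π-col Δ<k v with any? (λ γ → ¬? (colourAt? π v γ))
  ... | yes (α , absent) = α , λ g g≢e inc πg≡α → absent (g , g≢e , inc , πg≡α)
  ... | no all-present   = contradiction (begin-strict
      maxDegree G            <⟨ Δ<k ⟩
      k                      ≤⟨ injective⇒≤∣p∣ (incidentEdges v) edge-inj
                                                   (incident⇒∈incidentEdges ∘ edge-incident) ⟩
      ∣ incidentEdges v ∣    ≡⟨ sym (degree≡∣incidentEdges∣ v) ⟩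
      degree G v             ≤⟨ degree≤maxDegree v ⟩
      maxDegree G            ∎) (<-irrefl refl)
    where
    open ≤-Reasoning
    edge : ∀ γ → ∃[ g ] (g ≢ e × Incident G v g × π g ≡ γ)
    edge γ = ¬missing⇒present λ missing →
      all-present (γ , λ (g , g≢e , inc , πg≡γ) → missing g g≢e inc πg≡γ)
    edge-incident : ∀ γ → Incident G v (proj₁ (edge γ))
    edge-incident γ = proj₁ (proj₂ (proj₂ (edge γ)))
    edge-colour : ∀ γ → π (proj₁ (edge γ)) ≡ γ
    edge-colour γ = proj₂ (proj₂ (proj₂ (edge γ)))
    edge-inj : Injective _≡_ _≡_ (proj₁ ∘ edge)
    edge-inj {γ} {δ} same = trans (sym (edge-colour γ)) (trans (cong π same) (edge-colour δ))

  missing-cong : ∀ {π π′ v γ} → (∀ {g} → g ≢ e → Incident G v g → π′ g ≡ π g) →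
                 Missing G e k π v γ → Missing G e k π′ v γ
  missing-cong π′≡π γ-missing g g≢e v-g π′g≡γ =
    γ-missing g g≢e v-g (trans (sym (π′≡π g≢e v-g)) π′g≡γ)

  module KempeChange {π : Edge G → Fin k} (π-col : IsColoring G e k π)
      {K : Fin k → Set} (K? : Decidable K)
      {σ : Fin k → Fin k} (σ-inj : Injective _≡_ _≡_ σ) (σ-K : ∀ {γ} → K γ → K (σ γ))
      (S : Subset n) (S-closed : ∀ g → g ≢ e → K (π g) → ¬ InBoundary G (_∈ S) g) where

    Switched : Edge G → Set
    Switched g = src g ∈ S × K (π g)

    recoloured : Edge G → Fin k
    recoloured g with (src g ∈? S) ×-dec K? (π g)
    ... | yes _ = σ (π g)
    ... | no  _ = π g

    recoloured-view : ∀ g → (Switched g × recoloured g ≡ σ (π g))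
                          ⊎ (¬ Switched g × recoloured g ≡ π g)
    recoloured-view g with (src g ∈? S) ×-dec K? (π g)
    ... | yes sw = inj₁ (sw , refl)
    ... | no ¬sw = inj₂ (¬sw , refl)

    private
      end∈S⇒src∈S : ∀ {g x} → g ≢ e → K (π g) → Incident G x g → x ∈ S → src g ∈ S
      end∈S⇒src∈S g≢e Kg (inj₁ refl) x∈S = x∈S
      end∈S⇒src∈S {g} g≢e Kg (inj₂ refl) t∈S with src g ∈? S
      ... | yes s∈S = s∈S
      ... | no s∉S  = contradiction (inj₂ (s∉S , t∈S)) (S-closed g g≢e Kg)

      src∈S⇒end∈S : ∀ {g x} → g ≢ e → K (π g) → Incident G x g → src g ∈ S → x ∈ S
      src∈S⇒end∈S g≢e Kg (inj₁ refl) s∈S = s∈S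
      src∈S⇒end∈S {g} g≢e Kg (inj₂ refl) s∈S with tgt g ∈? S
      ... | yes t∈S = t∈S
      ... | no t∉S  = contradiction (inj₁ (s∈S , t∉S)) (S-closed g g≢e Kg)

      switched-unswitched : ∀ {g h x} → g ≢ e → h ≢ e → Incident G x g → Incident G x h →
                            Switched g → ¬ Switched h → σ (π g) ≢ π h
      switched-unswitched g≢e h≢e x-g x-h (s∈S , Kg) ¬sw σπg≡πh =
        ¬sw (end∈S⇒src∈S h≢e Kh x-h (src∈S⇒end∈S g≢e Kg x-g s∈S) , Kh)
        where
        Kh = subst K σπg≡πh (σ-K Kg)

    recoloured-outside : ∀ {g x} → g ≢ e → Incident G x g → x ∉ S → recoloured g ≡ π g
    recoloured-outside {g} g≢e x-g x∉S with recoloured-view g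
    ... | inj₁ ((s∈S , Kg) , _) = contradiction (src∈S⇒end∈S g≢e Kg x-g s∈S) x∉S
    ... | inj₂ (_ , unchanged)   = unchanged

    recoloured-isColoring : IsColoring G e k recoloured
    recoloured-isColoring g h g≢e h≢e g≢h (x , x-g , x-h) same
      with recoloured-view g | recoloured-view h
    ... | inj₁ (_ , eg) | inj₁ (_ , eh) =
      π-col g h g≢e h≢e g≢h (x , x-g , x-h) (σ-inj (trans (sym eg) (trans same eh)))
    ... | inj₂ (_ , eg) | inj₂ (_ , eh) =
      π-col g h g≢e h≢e g≢h (x , x-g , x-h) (trans (sym eg) (trans same eh))
    ... | inj₁ (sw , eg) | inj₂ (¬sw , eh) =
      switched-unswitched g≢e h≢e x-g x-h sw ¬sw (trans (sym eg) (trans same eh))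
    ... | inj₂ (¬sw , eg) | inj₁ (sw , eh) =
      switched-unswitched h≢e g≢e x-h x-g sw ¬sw (trans (sym eh) (trans (sym same) eg))

    recoloured-missing : ∀ {u c α} → u ∈ S → K α → σ c ≡ α →
                         Missing G e k π u c → Missing G e k recoloured u α
    recoloured-missing u∈S Kα σc≡α c-missing g g≢e u-g π′g≡α with recoloured-view g
    ... | inj₁ (_ , eg) = c-missing g g≢e u-g (σ-inj (trans (sym eg) (trans π′g≡α (sym σc≡α))))
    ... | inj₂ (¬sw , eg) = ¬sw (end∈S⇒src∈S g≢e Kg u-g u∈S , Kg)
      where
      Kg = subst K (sym (trans (sym eg) π′g≡α)) Kα

  module _ (T : TreeSeq G e) where
    open TreeSeq T

    incident-e⇒InT : ∀ {x} → Incident G x e → InT G T x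
    incident-e⇒InT x-e
      with i , _ , e-joins ← joins zero
      with joins-ends (subst (Joins G (y (suc zero)) (y i)) first e-joins) x-e
    ... | inj₁ x≡y₁ = suc zero , sym x≡y₁
    ... | inj₂ x≡yᵢ = i , sym x≡yᵢ

    module _ {C : Fin k → Set} {φ π : Edge G → Fin k} (stable : Stable G T C φ π) where
      private
        π-col = proj₁ stable
        agrees = proj₁ (proj₂ stable)
        same-missing = proj₂ (proj₂ stable)

      missingSet-φ : ∀ {γ} → MissingSet G e k π (InT G T) γ → MissingSet G e k φ (InT G T) γ
      missingSet-φ (w , w∈T , γ-missing) = w , w∈T , proj₁ (same-missing w w∈T _) γ-missing

      stable-preserves-closed : Closed G e k (InT G T) φ → Closed G e k (InT G T) π
      stable-preserves-closed φ-closed g g≢e g-crosses πg∈π̄T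
        with x , x∈T , x-g ← boundary-inner-end g-crosses
        with colourAt? φ x (π g)
      ... | no absent = proj₂ (same-missing x x∈T (π g)) πg-missing g g≢e x-g refl
        where
        πg-missing : Missing G e k φ x (π g)
        πg-missing h h≢e x-h φh≡πg = absent (h , h≢e , x-h , φh≡πg)
      ... | yes (h , h≢e , x-h , φh≡πg)
        with φh∈φ̄T ← subst (MissingSet G e k φ (InT G T)) (sym φh≡πg) (missingSet-φ πg∈π̄T)
        with h ≟ g
      ...   | yes refl = φ-closed g g≢e g-crosses φh∈φ̄T
      ...   | no h≢g   = π-col h g h≢e g≢e h≢g (x , x-h , x-g)
                           (trans (agrees h h≢e (x , x∈T , x-h) (inj₁ φh∈φ̄T)) φh≡πg)

      stable-transfer : ∀ {π′} → IsColoring G e k π′ →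
                        (∀ {g x} → g ≢ e → InT G T x → Incident G x g → π′ g ≡ π g) →
                        Stable G T C φ π′
      stable-transfer π′-col π′≡π =
        π′-col ,
        (λ g g≢e (x , x∈T , x-g) φg∈ →
           trans (π′≡π g≢e x∈T x-g) (agrees g g≢e (x , x∈T , x-g) φg∈)) ,
        λ v v∈T γ →
          proj₁ (same-missing v v∈T γ) ∘ missing-cong (λ g≢e v-g → sym (π′≡π g≢e v∈T v-g)) ,
          missing-cong (λ g≢e v-g → π′≡π g≢e v∈T v-g) ∘ proj₂ (same-missing v v∈T γ)

      kempe-outside : Closed G e k (InT G T) φ → ∀ {u c α} → ¬ InT G T u → Missing G e k π u c →
                      MissingSet G e k π (InT G T) c → MissingSet G e k π (InT G T) α →
                      ∃[ π′ ] (Stable G T C φ π′ × Missing G e k π′ u α ×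
                               (∀ {g x} → g ≢ e → InT G T x → Incident G x g → π′ g ≡ π g))
      kempe-outside φ-closed {u} {c} {α} u∉T c-missing c∈π̄T α∈π̄T =
        let S , u∈S , S-avoids-T , S-closed = closedRegionAvoiding pairEdge? pairEdge-stays u u∉T
            open KempeChange π-col pair? (transpose-injective c α) transpose-preserves-pair
                             S (λ g g≢e pair → S-closed g (g≢e , pair))
            unchanged : ∀ {g x} → g ≢ e → InT G T x → Incident G x g → recoloured g ≡ π g
            unchanged g≢e x∈T x-g = recoloured-outside g≢e x-g (λ x∈S → S-avoids-T _ x∈S x∈T)
        in recoloured , stable-transfer recoloured-isColoring unchanged ,
           recoloured-missing u∈S (inj₂ refl) (transpose-matchˡ c α) c-missing , unchanged
        where
        Pair : Fin k → Set
        Pair γ = γ ≡ c ⊎ γ ≡ α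
        pair? : Decidable Pair
        pair? γ = (γ ≟ c) ⊎-dec (γ ≟ α)
        pairEdge? : Decidable (λ g → g ≢ e × Pair (π g))
        pairEdge? g = ¬? (g ≟ e) ×-dec pair? (π g)
        pair∈π̄T : ∀ {γ} → Pair γ → MissingSet G e k π (InT G T) γ
        pair∈π̄T (inj₁ refl) = c∈π̄T
        pair∈π̄T (inj₂ refl) = α∈π̄T
        pairEdge-stays : ∀ g → g ≢ e × Pair (π g) → ¬ InBoundary G (InT G T) g
        pairEdge-stays g (g≢e , pair) crosses =
          stable-preserves-closed φ-closed g g≢e crosses (pair∈π̄T pair)

    single-edge-exit : ∀ {π α β f u v} → Joins G v u f → f ≢ e → InT G T v → ¬ InT G T u →
                       π f ≡ β → Missing G e k π u α → IsExit G T π α β v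
    single-edge-exit {π} {α} {β} {f} {u} {v} f-joins f≢e v∈T u∉T πf≡β α-missing = record
      { q          = 0
      ; vs         = path
      ; gs         = λ _ → f
      ; vs-inj     = path-injective
      ; start      = refl
      ; gs-join    = λ { zero → f-joins }
      ; gs-ne      = λ _ → f≢e
      ; gs-col     = λ _ → inj₂ πf≡β
      ; alt        = λ ()
      ; meetT      = λ { zero _ → refl ; (suc zero) u∈T → contradiction u∈T u∉T }
      ; endMissing = inj₁ α-missing
      }
      where
      path : Fin 2 → Vtx G
      path zero    = v
      path (suc _) = u
      path-injective : Injective _≡_ _≡_ path
      path-injective {zero}     {zero}     _   = refl
      path-injective {zero}     {suc zero} v≡u = contradiction (subst (InT G T) v≡u v∈T) u∉T
      path-injective {suc zero} {zero}     u≡v = contradiction (subst (InT G T) (sym u≡v) v∈T) u∉T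
      path-injective {suc zero} {suc zero} _   = refl

lemma2p6 : (G : Multigraph) (e : Edge G) (k : ℕ) → suc (maxDegree G) ≤ k →
    (T : TreeSeq G e) (C : Fin k → Set) (φ : Edge G → Fin k) → IsColoring G e k φ →
    Closed G e k (InT G T) φ →
    (f : Edge G) (u v : Vtx G) → Joins G u v f → ¬ InT G T u → InT G T v →
    (∃[ π ] (Stable G T (λ c → C c ⊎ c ≡ φ f) φ π ×
    ∃[ c ] (Missing G e k π u c × MissingSet G e k π (InT G T) c))) →
    NonExtendable G T C φ f v
lemma2p6 G e k Δ<k T C φ _ φ-closed f u v f-joins u∉T v∈T (π , π-stable , c , c∈π̄u , c∈π̄T) =
  let α , α∈π̄v = missing-colour (proj₁ π-stable) Δ<k v
      π′ , π′-stable , α∈π̄′u , π′≡π =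
        kempe-outside T {C = λ γ → C γ ⊎ γ ≡ φ f} π-stable φ-closed
                      u∉T c∈π̄u c∈π̄T (v , v∈T , α∈π̄v)
  in π′ , π′-stable , α , missing-cong (λ g≢e v-g → π′≡π g≢e v∈T v-g) α∈π̄v ,
     single-edge-exit T (swap f-joins) f≢e v∈T u∉T (trans (π′≡π f≢e v∈T v-f) πf≡φf) α∈π̄′u
  where
  open Incidence G
  open Colourings G e k
  v-f : Incident G v f
  v-f = joins-incidentʳ f-joins
  f≢e : f ≢ e
  f≢e refl = u∉T (incident-e⇒InT T (joins-incidentˡ f-joins))
  πf≡φf : π f ≡ φ f
  πf≡φf = proj₁ (proj₂ π-stable) f f≢e (v , v∈T , v-f) (inj₂ (inj₂ refl))
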